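{- Let $T_{\mathrm{own}}$ be a transport functor from $\mathsf{Fin}^I$ to $\mathsf{Fin}$ deduced from a transport situation $(T,(\mathrm{own}_i)_{i\in I})$, and assume the web functor $T$ is continuous. Then $T_{\mathrm{own}}$ is exactly continuous.
   Context: Finiteness spaces $\mathcal A=(|\mathcal A|,\mathfrak F(\mathcal A))$: a set with $\mathfrak F(\mathcal A)\subseteq\mathcal P(|\mathcal A|)$ equal to its bidual, where $\mathfrak A^\perp=\{a': a\cap a'\text{ finite }\forall a\in\mathfrak A\}$; $\mathcal A^\perp=(|\mathcal A|,\mathfrak F(\mathcal A)^\perp)$. For relations: $f[a]$ direct image, $f^\dagger$ reverse, quasi-functional means $f[\{\alpha\}]$ finite for all $\alpha$; $f$ is finitary from $\mathcal A$ to $\mathcal B$ if $f[a]\in\mathfrak F(\mathcal B)$ for $a\in\mathfrak F(\mathcal A)$ and $f^\dagger[b']\in\mathfrak F(\mathcal A^\perp)$ for $b'\in\mathfrak F(\mathcal B^\perp)$. A functor $T$ from $\mathsf{Rel}^I$ to $\mathsf{Rel}$ assigns a set $T\vec A$ to each family of sets and a relation $T\vec f\subseteq T\vec A\times T\vec B$ to each family of relations $f_i\subseteq A_i\times B_i$ (independently of the chosen $A_i,B_i$), preserving componentwise identities and composition; it is continuous if, for every $I$-indexed family of families of sets $(A_{i,j})_{j\in J_i}$ each directed for inclusion, $T(\bigcup_{j\in J_i}A_{i,j})_{i\in I}=\bigcup_{\vec j\in\prod_iJ_i}T(A_{i,j_i})_{i\in I}$. A lax natural transformation $\phi$ from $T$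 to $U$ is a family $\phi_{\vec A}\subseteq T\vec A\times U\vec A$ with $\phi_{\vec B}\circ T\vec g\subseteq U\vec g\circ\phi_{\vec A}$. $\Pi_i$ is the $i$-th projection functor. A transport situation is such a $T$ with quasi-functional lax natural transformations $\mathrm{own}_i$ from $T$ to $\Pi_i$; $T_{\mathrm{own}}\vec{\mathcal A}$ is the finiteness space with web $T(|\mathcal A_i|)_i$ whose finitary subsets are the $\hat a$ with $\mathrm{own}_i[\hat a]\in\mathfrak F(\mathcal A_i)$ for all $i$, and $T_{\mathrm{own}}\vec f=T\vec f$; it is a transport functor when $T\vec f$ is finitary from $T_{\mathrm{own}}\vec{\mathcal A}$ to $T_{\mathrm{own}}\vec{\mathcal B}$ whenever each $f_i$ is finitary. Finiteness inclusion: $\mathcal A\sqsubseteq\mathcal B$ iff $|\mathcal A|\subseteq|\mathcal B|$ and $\mathfrak F(\mathcal A)\subseteq\mathfrak F(\mathcal B)$; the supremum $\bigsqcup_j\mathcal A_j$ has web $\bigcup_j|\mathcal A_j|$ and structure $(\bigcup_j\mathfrak F(\mathcal A_j))^{\perp\perp}$, and is exact if $\bigcup_j\mathfrak F(\mathcal A_j)$ is already a finiteness structure. A functor $\mathcal T$ from $\mathsf{Fin}^I$ to $\mathsf{Fin}$ is exactly continuous if it is $\sqsubseteq$-monotonic and, for every family $((\mathcal A_{i,j})_{j\in J_i})_{i\in I}$ with each $(\mathcal A_{i,j})_{j\in J_i}$ directed for $\sqsubseteq$ and each $\bigsqcup_{j}\mathcal A_{i,j}$ exact, the supremum $\bigsqcup_{\vec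 j\in\prod_iJ_i}\mathcal T(\mathcal A_{i,j_i})_{i\in I}$ is exact and equals $\mathcal T(\bigsqcup_{j\in J_i}\mathcal A_{i,j})_{i\in I}$. -}

module Defs where

open import Level using () renaming (zero to ℓ0; suc to lsuc)
open import Data.Product using (Σ; _×_; _,_; proj₁; proj₂)
open import Data.List using (List)
open import Data.List.Membership.Propositional using (_∈_)
open import Relation.Binary.PropositionalEquality using (_≡_)

Subset : Set → Set₁
Subset U = U → Set

_⊆_ : {U : Set} → Subset U → Subset U → Set
a ⊆ b = ∀ x → a x → b x

_≐_ : {U : Set} → Subset U → Subset U → Set
a ≐ b = (a ⊆ b) × (b ⊆ a)

_∩_ : {U : Set} → Subset U → Subset U → Subset U
(a ∩ b) x = a x × b x

⋃ : {U J : Set} → (J → Subset U) → Subset U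
⋃ {J = J} A x = Σ J λ j → A j x

singleton : {U : Set} → U → Subset U
singleton α x = x ≡ α

Finite : {U : Set} → Subset U → Set
Finite {U} a = Σ (List U) λ xs → ∀ x → a x → x ∈ xs

Rel : Set → Set → Set₁
Rel X Y = X → Y → Set

_⊆R_ : {X Y : Set} → Rel X Y → Rel X Y → Set
f ⊆R g = ∀ x y → f x y → g x y

_≐R_ : {X Y : Set} → Rel X Y → Rel X Y → Set
f ≐R g = (f ⊆R g) × (g ⊆R f)

_⊠_ : {X Y : Set} → Subset X → Subset Y → Rel X Y
(A ⊠ B) x y = A x × B y

-- g ∘R f : first f, then g
_∘R_ : {X Y Z : Set} → Rel Y Z → Rel X Y → Rel X Z
(_∘R_ {Y = Y} g f) x z = Σ Y λ y → f x y × g y z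

idRel : {X : Set} → Subset X → Rel X X
idRel A x y = A x × x ≡ y

image : {X Y : Set} → Rel X Y → Subset X → Subset Y
image {X} f a y = Σ X λ x → a x × f x y

rev : {X Y : Set} → Rel X Y → Rel Y X
rev f y x = f x y

QuasiFunctional : {X Y : Set} → Rel X Y → Set
QuasiFunctional {X} f = ∀ (α : X) → Finite (image f (singleton α))

Directed : {U J : Set} → (J → Subset U) → Set
Directed {J = J} A = J × (∀ j k → Σ J λ l → (A j ⊆ A l) × (A k ⊆ A l))

record FunctorRel (I U V : Set) : Set₁ where
  field
    obj : (I → Subset U) → Subset V
    mor : (I → Rel U U) → Rel V V
    obj-cong : ∀ A B → (∀ i → A i ≐ B i) → obj A ≐ obj B
    mor-cong : ∀ f g → (∀ i → f i ≐R g i) → mor f ≐R mor g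
    mor-typed : ∀ A B f → (∀ i → f i ⊆R (A i ⊠ B i)) → mor f ⊆R (obj A ⊠ obj B)
    pres-id : ∀ A → mor (λ i → idRel (A i)) ≐R idRel (obj A)
    pres-comp : ∀ f g → mor (λ i → g i ∘R f i) ≐R (mor g ∘R mor f)

open FunctorRel public

Continuous : {I U V : Set} → FunctorRel I U V → Set₁
Continuous {I} {U} T =
  ∀ (J : I → Set) (A : (i : I) → J i → Subset U) →
    (∀ i → Directed (A i)) →
    obj T (λ i → ⋃ (A i))
      ≐ ⋃ {J = (i : I) → J i} (λ js → obj T (λ i → A i (js i)))

IsLaxNatToProj : {I U V : Set} → FunctorRel I U V → I →
                 ((I → Subset U) → Rel V U) → Set₁
IsLaxNatToProj {I} T i φ =
  (∀ A → φ A ⊆R (obj T A ⊠ A i)) ×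
  (∀ A B → (∀ k → A k ≐ B k) → φ A ≐R φ B) ×
  (∀ A B g → (∀ k → g k ⊆R (A k ⊠ B k)) →
     (φ B ∘R mor T g) ⊆R (g i ∘R φ A))

record TransportSituation (I U V : Set) : Set₁ where
  field
    T : FunctorRel I U V
    own : I → (I → Subset U) → Rel V U
    own-lax : ∀ i → IsLaxNatToProj T i (own i)
    own-qf : ∀ i A → QuasiFunctional (own i A)

open TransportSituation public

record Raw (U : Set) : Set₂ where
  field
    web : Subset U
    fin : Subset U → Set₁

open Raw public

ortho : {U : Set} → Subset U → (Subset U → Set₁) → Subset U → Set₁
ortho W F a' = (a' ⊆ W) × (∀ a → F a → Finite (a ∩ a'))

IsFinStructure : {U : Set} → Subset U → (Subset U → Set₁) → Set₁
IsFinStructure W F =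
  ∀ a → (F a → ortho W (ortho W F) a) × (ortho W (ortho W F) a → F a)

record FinSpace (U : Set) : Set₂ where
  field
    raw : Raw U
    isFin : IsFinStructure (web raw) (fin raw)

open FinSpace public

_⊑_ : {U : Set} → Raw U → Raw U → Set₁
A ⊑ B = (web A ⊆ web B) × (∀ a → fin A a → fin B a)

_≈_ : {U : Set} → Raw U → Raw U → Set₁
A ≈ B = (web A ≐ web B) × (∀ a → (fin A a → fin B a) × (fin B a → fin A a))

⋃web : {U J : Set} → (J → Raw U) → Subset U
⋃web A = ⋃ (λ j → web (A j))

⋃fin : {U J : Set} → (J → Raw U) → Subset U → Set₁
⋃fin {J = J} A a = Σ J λ j → fin (A j) a

sup : {U J : Set} → (J → Raw U) → Raw U
web (sup A) = ⋃web A
fin (sup A) = ortho (⋃web A) (ortho (⋃web A) (⋃fin A))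

IsExact : {U J : Set} → (J → Raw U) → Set₁
IsExact A = IsFinStructure (⋃web A) (⋃fin A)

module _ {U : Set} (W : Subset U) where
  private
    anti : (F G : Subset U → Set₁) → (∀ a → F a → G a) →
           ∀ a' → ortho W G a' → ortho W F a'
    anti F G FG a' (s , h) = s , λ a Fa → h a (FG a Fa)

    comm : {a b : Subset U} → Finite (a ∩ b) → Finite (b ∩ a)
    comm (xs , p) = xs , λ x q → p x (proj₂ q , proj₁ q)

    unit : (F : Subset U → Set₁) → (∀ a → F a → a ⊆ W) →
           ∀ a → F a → ortho W (ortho W F) a
    unit F s a Fa = s a Fa , λ a' o → comm (proj₂ o a Fa)

  bidual-isFin : (F : Subset U → Set₁) → IsFinStructure W (ortho W (ortho W F))
  bidual-isFin F a =
    unit (ortho W (ortho W F)) (λ _ → proj₁) a ,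
    anti (ortho W F) (ortho W (ortho W (ortho W F)))
         (unit (ortho W F) (λ _ → proj₁)) a

supFin : {U J : Set} → (J → FinSpace U) → FinSpace U
raw (supFin A) = sup (λ j → raw (A j))
isFin (supFin A) = bidual-isFin (⋃web (λ j → raw (A j))) (⋃fin (λ j → raw (A j)))

Directed⊑ : {U J : Set} → (J → FinSpace U) → Set₁
Directed⊑ {J = J} A =
  J × (∀ j k → Σ J λ l → (raw (A j) ⊑ raw (A l)) × (raw (A k) ⊑ raw (A l)))

-- exact continuity of (the object part of) a functor Fin^I → Fin
ExactlyContinuous : {I U V : Set} → ((I → FinSpace U) → Raw V) → Set₂
ExactlyContinuous {I} {U} 𝒯 =
  (∀ (A B : I → FinSpace U) → (∀ i → raw (A i) ⊑ raw (B i)) → 𝒯 A ⊑ 𝒯 B) ×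
  (∀ (J : I → Set) (𝒜 : (i : I) → J i → FinSpace U) →
     (∀ i → Directed⊑ (𝒜 i)) →
     (∀ i → IsExact (λ j → raw (𝒜 i j))) →
     IsExact {J = (i : I) → J i} (λ js → 𝒯 (λ i → 𝒜 i (js i)))
     × (sup {J = (i : I) → J i} (λ js → 𝒯 (λ i → 𝒜 i (js i)))
          ≈ 𝒯 (λ i → supFin (𝒜 i))))

Finitary : {U : Set} → Raw U → Raw U → Rel U U → Set₁
Finitary A B f =
  (f ⊆R (web A ⊠ web B)) ×
  (∀ a → fin A a → fin B (image f a)) ×
  (∀ b' → ortho (web B) (fin B) b' → ortho (web A) (fin A) (image (rev f) b'))

Town : {I U V : Set} → TransportSituation I U V → (I → FinSpace U) → Raw V
web (Town S A) = obj (T S) (λ i → web (raw (A i)))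
fin (Town S A) â =
  (â ⊆ obj (T S) (λ i → web (raw (A i)))) ×
  (∀ i → fin (raw (A i)) (image (own S i (λ k → web (raw (A k)))) â))

IsTransportFunctor : {I U V : Set} → TransportSituation I U V → Set₂
IsTransportFunctor {I} {U} S =
  ∀ (A B : I → FinSpace U) (f : I → Rel U U) →
    (∀ i → Finitary (raw (A i)) (raw (B i)) (f i)) →
    Finitary (Town S A) (Town S B) (mor (T S) f)

module Submission where

-- Monotonicity of T_own rests on two facts about T and the lax transformations
-- own_i: T is monotone on objects, and own_i(A, α) does not change when A is
-- shrunk or enlarged around a family containing α (lax naturality at identity
-- relations).
--
-- For a directed family 𝒜 with exact suprema put G(js) = T_own(𝒜_{i,js_i}).
-- The webs of ⊔ G and T_own(⊔𝒜) agree by continuity of T.  For finitary sets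
--   ⋃ F(G js)  ⊆  (⋃ F(G js))^⊥⊥  ⊆  F(T_own ⊔𝒜)  ⊆  ⋃ F(G js),
-- which gives exactness and the equation at once.  The first inclusion holds
-- for any family; the second is an orthogonality argument using a classical
-- choice of owners and quasi-functionality of own_i; the third uses exactness
-- of each ⊔_j 𝒜_{i,j} together with the support lemma
--   α ∈ T A  ⟹  α ∈ T (own_i(A, α))_i .
-- To prove it, continuity reduces to a finite A; then the points outside
-- own(α) are sent to infinitely many disjoint fresh copies, and finitarity of
-- the collapsing relation (T is a transport functor) forces two of the
-- resulting elements to coincide, which confines α to own(α).  Fresh copies
-- need U infinite; if U is finite, a single index covers every web.
-- Excluded middle is used to decide membership and to choose witnesses.

open import Defs
open import Level using (Lift; lift; lower) renaming (zero to ℓ0; suc to lsuc)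
open import Axiom.ExcludedMiddle using (ExcludedMiddle)
open import Data.Product using (Σ; _×_; _,_; proj₁; proj₂; swap)
open import Data.Sum using (_⊎_; inj₁; inj₂)
open import Data.Empty using (⊥; ⊥-elim)
open import Data.Unit using (⊤; tt)
open import Data.Nat using (ℕ; zero; suc; _+_; _*_; _<_; _%_)
open import Data.Nat.Properties using (+-comm; +-cancelʳ-≡; *-cancelʳ-≡; <-cmp; m<1+n⇒m<n∨m≡n; n<1+n; <⇒≢)
open import Data.Nat.DivMod using ([m+kn]%n≡m%n; m<n⇒m%n≡m)
open import Data.Fin using (Fin; toℕ)
open import Data.Fin.Properties using (toℕ<n; toℕ-injective; pigeonhole)
open import Data.List using (List; []; _∷_; _++_; length; lookup; concatMap)
open import Data.List.Relation.Unary.Any using (here; there; index)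
open import Data.List.Relation.Unary.Any.Properties using (lookup-index)
open import Data.List.Membership.Propositional using (_∈_; _∉_)
open import Data.List.Membership.Propositional.Properties using (∈-++⁺ˡ; ∈-++⁺ʳ; ∈-map⁺; ∈-concat⁺′)
open import Relation.Nullary using (¬_; Dec; yes; no)
open import Relation.Nullary.Decidable using (map′; decidable-stable)
open import Relation.Binary.PropositionalEquality using (_≡_; _≢_; refl; sym; trans; cong; subst)
open import Relation.Binary using (tri<; tri≈; tri>)

index-injective : {X : Set} {xs : List X} {x y : X} (p : x ∈ xs) (q : y ∈ xs) →
                  index p ≡ index q → x ≡ y
index-injective {xs = xs} p q same =
  trans (lookup-index p) (trans (cong (lookup xs) same) (sym (lookup-index q)))

pair-injective : ∀ {L} n k (p q : Fin L) → n * L + toℕ p ≡ k * L + toℕ q → n ≡ k × p ≡ q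
pair-injective {suc L} n k p q eq = quotients , p≡q
  where
  remainder : ∀ m (r : Fin (suc L)) → (m * suc L + toℕ r) % suc L ≡ toℕ r
  remainder m r = trans (cong (_% suc L) (+-comm (m * suc L) (toℕ r)))
                        (trans ([m+kn]%n≡m%n (toℕ r) m (suc L)) (m<n⇒m%n≡m (toℕ<n r)))
  p≡q : p ≡ q
  p≡q = toℕ-injective (trans (sym (remainder n p)) (trans (cong (_% suc L) eq) (remainder k q)))
  quotients : n ≡ k
  quotients = *-cancelʳ-≡ n k (suc L)
    (+-cancelʳ-≡ (toℕ p) _ _ (trans eq (cong (λ r → k * suc L + toℕ r) (sym p≡q))))

Finite-⊆ : {X : Set} {a b : Subset X} → a ⊆ b → Finite b → Finite a
Finite-⊆ a⊆b (xs , b⊆xs) = xs , λ x ax → b⊆xs x (a⊆b x ax)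

Finite-image : {X Y : Set} {f : Rel X Y} {a : Subset X} →
               QuasiFunctional f → Finite a → Finite (image f a)
Finite-image {X} {Y} qf (xs , a⊆xs) =
  concatMap images xs ,
  λ { y (x , ax , fxy) → ∈-concat⁺′ (proj₂ (qf x) y (x , refl , fxy)) (∈-map⁺ images (a⊆xs x ax)) }
  where
  images : X → List Y
  images x = proj₁ (qf x)

finite-range-repeats : {X : Set} (s : ℕ → X) → Finite (λ x → Σ ℕ λ n → s n ≡ x) →
                       Σ ℕ λ n → Σ ℕ λ m → n ≢ m × s n ≡ s m
finite-range-repeats s (K , range⊆K) =
  let n , m , n<m , same = pigeonhole (n<1+n (length K)) position
  in toℕ n , toℕ m , <⇒≢ n<m , index-injective _ _ same
  where
  position : Fin (suc (length K)) → Fin (length K)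
  position n = index (range⊆K (s (toℕ n)) (toℕ n , refl))

module Classical (em : ExcludedMiddle (lsuc ℓ0)) where

  decide : (P : Set) → Dec P
  decide P = map′ lower lift (em {Lift (lsuc ℓ0) P})

  witness : {X : Set} → (X → Set) → Subset X
  witness {X} P x with decide (Σ X P)
  ... | yes (x₀ , _) = x₀ ≡ x
  ... | no _ = ⊥

  witness-sound : {X : Set} (P : X → Set) → witness P ⊆ P
  witness-sound {X} P x w with decide (Σ X P)
  ... | yes (x₀ , Px₀) = subst P w Px₀
  ... | no _ = ⊥-elim w

  witness-exists : {X : Set} (P : X → Set) → Σ X P → Σ X (witness P)
  witness-exists {X} P inhabited with decide (Σ X P)
  ... | yes (x₀ , _) = x₀ , refl
  ... | no empty = ⊥-elim (empty inhabited)

  witness-finite : {X : Set} (P : X → Set) → Finite (witness P)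
  witness-finite {X} P with decide (Σ X P)
  ... | yes (x₀ , _) = x₀ ∷ [] , λ { x refl → here refl }
  ... | no _ = [] , λ x ()

  finite-or-infinite : {X : Set} → (Σ (List X) λ xs → ∀ x → x ∈ xs) ⊎ ((ys : List X) → Σ X (_∉ ys))
  finite-or-infinite {X} with decide (Σ (List X) λ xs → ∀ x → x ∈ xs)
  ... | yes listed = inj₁ listed
  ... | no unlisted = inj₂ λ ys → decidable-stable (decide _) λ no-fresh →
          unlisted (ys , λ x → decidable-stable (decide (x ∈ ys)) λ x∉ys → no-fresh (x , x∉ys))

  directed-bound : {X J : Set} (A : J → Subset X) → Directed A → (L : List X) →
                   Σ J λ j → ∀ x → x ∈ L → ⋃ A x → A j x
  directed-bound A (j₀ , _) [] = j₀ , λ x ()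
  directed-bound A dir@(_ , upper) (x ∷ L) with directed-bound A dir L | decide (⋃ A x)
  ... | j , L⊆Aj | no x∉⋃ = j , λ { y (here refl) y∈⋃ → ⊥-elim (x∉⋃ y∈⋃)
                                  ; y (there y∈L) y∈⋃ → L⊆Aj y y∈L y∈⋃ }
  ... | j , L⊆Aj | yes (j' , x∈Aj') with upper j j'
  ...   | l , Aj⊆Al , Aj'⊆Al = l , λ { y (here refl) _ → Aj'⊆Al y x∈Aj'
                                    ; y (there y∈L) y∈⋃ → Aj⊆Al y (L⊆Aj y y∈L y∈⋃) }

-- Fresh copies: given a supply of fresh elements, infinitely many pairwise
-- disjoint copies of a list xs, all outside xs.
module FreshCopies {U : Set} (fresh : (ys : List U) → Σ U (_∉ ys)) (xs : List U) where

  earlier : ℕ → List U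
  v : ℕ → U
  v k = proj₁ (fresh (xs ++ earlier k))
  earlier zero = []
  earlier (suc k) = v k ∷ earlier k

  v-fresh : ∀ k → v k ∉ xs ++ earlier k
  v-fresh k = proj₂ (fresh (xs ++ earlier k))

  earlier-∋ : ∀ {j k} → j < k → v j ∈ earlier k
  earlier-∋ {j} {suc k} j<1+k with m<1+n⇒m<n∨m≡n j<1+k
  ... | inj₁ j<k = there (earlier-∋ j<k)
  ... | inj₂ refl = here refl

  v-injective : ∀ j k → v j ≡ v k → j ≡ k
  v-injective j k eq with <-cmp j k
  ... | tri< j<k _ _ = ⊥-elim (v-fresh k (∈-++⁺ʳ xs (subst (_∈ earlier k) eq (earlier-∋ j<k))))
  ... | tri≈ _ j≡k _ = j≡k
  ... | tri> _ _ k<j = ⊥-elim (v-fresh j (∈-++⁺ʳ xs (subst (_∈ earlier j) (sym eq) (earlier-∋ k<j))))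

  copy : ℕ → Fin (length xs) → U
  copy n p = v (n * length xs + toℕ p)

  copy∉xs : ∀ n p → copy n p ∉ xs
  copy∉xs n p c∈xs = v-fresh _ (∈-++⁺ˡ c∈xs)

  copy-injective : ∀ n k p q → copy n p ≡ copy k q → n ≡ k × p ≡ q
  copy-injective n k p q eq = pair-injective n k p q (v-injective _ _ eq)

module _ {U : Set} (X : FinSpace U) where

  fin⊆web : ∀ a → fin (raw X) a → a ⊆ web (raw X)
  fin⊆web a fa = proj₁ (proj₁ (isFin X a) fa)

  fin-⊆ : ∀ a b → a ⊆ b → fin (raw X) b → fin (raw X) a
  fin-⊆ a b a⊆b fb with proj₁ (isFin X b) fb
  ... | b⊆web , b⊥⊥ = proj₂ (isFin X a)
    ((λ x ax → b⊆web x (a⊆b x ax)) ,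
     λ a' a'⊥ → Finite-⊆ (λ x (a'x , ax) → a'x , a⊆b x ax) (b⊥⊥ a' a'⊥))

  finite-fin : ∀ a → Finite a → a ⊆ web (raw X) → fin (raw X) a
  finite-fin a finite a⊆web = proj₂ (isFin X a) (a⊆web , λ a' _ → Finite-⊆ (λ _ → proj₂) finite)

⊆bidual : {U : Set} (W : Subset U) (F : Subset U → Set₁) → (∀ a → F a → a ⊆ W) →
          ∀ a → F a → ortho W (ortho W F) a
⊆bidual W F F⊆W a Fa =
  F⊆W a Fa , λ a' (_ , a'⊥) → Finite-⊆ (λ x (a'x , ax) → ax , a'x) (a'⊥ a Fa)

finiteSubsets : {U : Set} → FinSpace U
web (raw finiteSubsets) _ = ⊤
fin (raw finiteSubsets) a = Lift (lsuc ℓ0) (Finite a)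
isFin finiteSubsets a =
  (λ (lift finite) → (λ _ _ → tt) , λ a' _ → Finite-⊆ (λ _ → proj₂) finite) ,
  (λ (_ , a⊥⊥) → lift (Finite-⊆ (λ x ax → tt , ax) (a⊥⊥ (λ _ → ⊤) everything-antifinitary)))
  where
  everything-antifinitary : ortho (λ _ → ⊤) (λ a → Lift (lsuc ℓ0) (Finite a)) (λ _ → ⊤)
  everything-antifinitary = (λ _ _ → tt) , λ c (lift finite) → Finite-⊆ (λ _ → proj₁) finite

allSubsets : {U : Set} (W : Subset U) → Finite W → FinSpace U
web (raw (allSubsets W _)) = W
fin (raw (allSubsets W _)) a = Lift (lsuc ℓ0) (a ⊆ W)
isFin (allSubsets W finite) a =
  (λ (lift a⊆W) → a⊆W , λ a' _ → Finite-⊆ (λ x (_ , ax) → a⊆W x ax) finite) ,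
  (λ (a⊆W , _) → lift a⊆W)

module FunctorFacts {I U V : Set} (T : FunctorRel I U V) where

  id-typed : {A B C : I → Subset U} → (∀ i → A i ⊆ B i) → (∀ i → A i ⊆ C i) →
             ∀ i → idRel (A i) ⊆R (B i ⊠ C i)
  id-typed A⊆B A⊆C i x _ (ax , refl) = A⊆B i x ax , A⊆C i x ax

  id-refl : (A : I → Subset U) → ∀ α → obj T A α → mor T (λ i → idRel (A i)) α α
  id-refl A α αA = proj₂ (pres-id T A) α α (αA , refl)

  -- T is monotone on objects: T(id_A) relates T A to T B whenever A ⊆ B
  obj-mono : (A B : I → Subset U) → (∀ i → A i ⊆ B i) → obj T A ⊆ obj T B
  obj-mono A B A⊆B α αA =
    proj₂ (mor-typed T A B (λ i → idRel (A i)) (id-typed (λ _ _ ax → ax) A⊆B) α α (id-refl A α αA))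

  -- T preserves binary intersections, since id_B ∘ id_A = id_{A ∩ B}.
  obj-∩ : (A B : I → Subset U) → ∀ α → obj T A α → obj T B α → obj T (λ i → A i ∩ B i) α
  obj-∩ A B α αA αB = proj₁ (proj₁ (pres-id T (λ i → A i ∩ B i)) α α
    (proj₁ (mor-cong T _ _ composite) α α
      (proj₂ (pres-comp T (λ i → idRel (A i)) (λ i → idRel (B i))) α α
        (α , id-refl A α αA , id-refl B α αB))))
    where
    composite : ∀ i → (idRel (B i) ∘R idRel (A i)) ≐R idRel (A i ∩ B i)
    composite i = (λ { x _ (_ , (ax , refl) , (bx , refl)) → (ax , bx) , refl }) ,
                  (λ { x _ ((ax , bx) , refl) → x , (ax , refl) , (bx , refl) })

  factor-identity : (A : I → Subset U) (f g : I → Rel U U) →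
                    (∀ i → (g i ∘R f i) ≐R idRel (A i)) →
                    ∀ α → obj T A α → Σ V λ β → mor T f α β × mor T g β α
  factor-identity A f g g∘f≡id α αA =
    proj₁ (pres-comp T f g) α α (proj₂ (mor-cong T _ _ g∘f≡id) α α (id-refl A α αA))

  restriction-identity : (B : I → Subset U) (g : I → Rel U U) →
                         (∀ i → (g i ∘R idRel (B i)) ≐R idRel (B i)) →
                         ∀ β α → obj T B β → mor T g β α → obj T B α
  restriction-identity B g g-on-B β α βB βgα
    with proj₁ (pres-id T B) β α
           (proj₁ (mor-cong T _ _ g-on-B) β α
             (proj₂ (pres-comp T (λ i → idRel (B i)) g) β α (β , id-refl B β βB , βgα)))
  ... | βB' , refl = βB'

module OwnFacts {I U V : Set} (S : TransportSituation I U V) where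
  open FunctorFacts (T S)

  own-typed : ∀ i A α → own S i A α ⊆ A i
  own-typed i A α y o = proj₂ (proj₁ (own-lax S i) A α y o)

  own-transfer : ∀ i (A B C : I → Subset U) → (∀ k → A k ⊆ B k) → (∀ k → A k ⊆ C k) →
                 ∀ α → obj (T S) A α → own S i C α ⊆ own S i B α
  own-transfer i A B C A⊆B A⊆C α αA y o
    with proj₂ (proj₂ (own-lax S i)) B C (λ k → idRel (A k)) (id-typed A⊆B A⊆C) α y
           (α , id-refl A α αA , o)
  ... | _ , o' , (_ , refl) = o'

  own-shrink : ∀ i (A B : I → Subset U) → (∀ k → A k ⊆ B k) →
               ∀ α → obj (T S) A α → own S i B α ⊆ own S i A α
  own-shrink i A B A⊆B = own-transfer i A A B (λ _ _ ax → ax) A⊆B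

  own-grow : ∀ i (A B : I → Subset U) → (∀ k → A k ⊆ B k) →
             ∀ α → obj (T S) A α → own S i A α ⊆ own S i B α
  own-grow i A B A⊆B = own-transfer i A B A A⊆B (λ _ _ ax → ax)

Town-mono : {I U V : Set} (S : TransportSituation I U V) (A B : I → FinSpace U) →
            (∀ i → raw (A i) ⊑ raw (B i)) → Town S A ⊑ Town S B
Town-mono {I} {U} S A B A⊑B =
  obj-mono WA WB WA⊆WB ,
  λ â (â⊆TA , own-fin) → (λ α âα → obj-mono WA WB WA⊆WB α (â⊆TA α âα)) ,
    λ i → fin-⊆ (B i) _ _
            (λ y (α , âα , o) → α , âα , own-shrink i WA WB WA⊆WB α (â⊆TA α âα) y o)
            (proj₂ (A⊑B i) _ (own-fin i))
  where
  open FunctorFacts (T S)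
  open OwnFacts S
  WA WB : I → Subset U
  WA i = web (raw (A i))
  WB i = web (raw (B i))
  WA⊆WB : ∀ i → WA i ⊆ WB i
  WA⊆WB i = proj₁ (A⊑B i)

module SupportLemma {I U V : Set} (em : ExcludedMiddle (lsuc ℓ0)) (S : TransportSituation I U V)
  (transport : IsTransportFunctor S) (cont : Continuous (T S))
  (fresh : (ys : List U) → Σ U (_∉ ys)) where
  open Classical em
  open FunctorFacts (T S)
  open OwnFacts S

  Everything : I → Subset U
  Everything _ _ = ⊤

  finite-support : ∀ A α → obj (T S) A α →
                   Σ (I → List U) λ xs → obj (T S) (λ i → (_∈ xs i) ∩ A i) α
  finite-support A α αA =
    proj₁ (cont (λ _ → List U) pieces directed) α (proj₁ (obj-cong (T S) A _ covered) α αA)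
    where
    pieces : (i : I) → List U → Subset U
    pieces i ys = (_∈ ys) ∩ A i
    directed : ∀ i → Directed (pieces i)
    directed i = [] , λ ys zs → ys ++ zs , (λ y (m , a) → ∈-++⁺ˡ m , a)
                                          , (λ y (m , a) → ∈-++⁺ʳ ys m , a)
    covered : ∀ i → A i ≐ ⋃ (pieces i)
    covered i = (λ y a → y ∷ [] , here refl , a) , (λ y (_ , _ , a) → a)

  module Core (F : I → Subset U) (xs : I → List U) (F⊆xs : ∀ i → F i ⊆ (_∈ xs i))
              (α : V) (αF : obj (T S) F α) where

    B : I → Subset U
    B i = own S i F α

    B⊆F : ∀ i → B i ⊆ F i
    B⊆F i = own-typed i F α

    copy : ∀ i → ℕ → ∀ x → F i x → U
    copy i n x Fx = FreshCopies.copy fresh (xs i) n (index (F⊆xs i x Fx))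

    F∌copy : ∀ i n x Fx → ¬ F i (copy i n x Fx)
    F∌copy i n x Fx Fc = FreshCopies.copy∉xs fresh (xs i) n _ (F⊆xs i _ Fc)

    copy-injective : ∀ i n k x w Fx Fw → copy i n x Fx ≡ copy i k w Fw → n ≡ k × x ≡ w
    copy-injective i n k x w Fx Fw same
      with FreshCopies.copy-injective fresh (xs i) n k _ _ same
    ... | n≡k , same-index = n≡k , index-injective _ _ same-index

    spread : ℕ → I → Rel U U
    spread n i x y = (B i x × x ≡ y) ⊎ (Σ (F i x) λ Fx → ¬ B i x × copy i n x Fx ≡ y)

    -- collapse: a common left inverse of all the spread n
    collapse : I → Rel U U
    collapse i c x = (B i x × x ≡ c) ⊎ (Σ ℕ λ n → Σ (F i x) λ Fx → copy i n x Fx ≡ c)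

    collapse∘spread : ∀ n i → (collapse i ∘R spread n i) ≐R idRel (F i)
    collapse∘spread n i = to , from
      where
      to : (collapse i ∘R spread n i) ⊆R idRel (F i)
      to x _ (_ , inj₁ (Bx , refl) , inj₁ (_ , refl)) = B⊆F i x Bx , refl
      to x w (_ , inj₁ (Bx , refl) , inj₂ (k , Fw , c≡x)) =
        ⊥-elim (F∌copy i k w Fw (subst (F i) (sym c≡x) (B⊆F i x Bx)))
      to x w (_ , inj₂ (Fx , _ , refl) , inj₁ (Bw , w≡c)) =
        ⊥-elim (F∌copy i n x Fx (subst (F i) w≡c (B⊆F i w Bw)))
      to x w (_ , inj₂ (Fx , _ , refl) , inj₂ (k , Fw , same)) =
        Fx , proj₂ (copy-injective i n k x w Fx Fw (sym same))
      from : idRel (F i) ⊆R (collapse i ∘R spread n i)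
      from x _ (Fx , refl) with decide (B i x)
      ... | yes Bx = x , inj₁ (Bx , refl) , inj₁ (Bx , refl)
      ... | no ¬Bx = copy i n x Fx , inj₂ (Fx , ¬Bx , refl) , inj₂ (n , Fx , refl)

    collapse-on-B : ∀ i → (collapse i ∘R idRel (B i)) ≐R idRel (B i)
    collapse-on-B i =
      (λ { x _ (_ , (Bx , refl) , inj₁ (_ , refl)) → Bx , refl
         ; x y (_ , (Bx , refl) , inj₂ (k , Fy , c≡x)) →
             ⊥-elim (F∌copy i k y Fy (subst (F i) (sym c≡x) (B⊆F i x Bx))) }) ,
      (λ { x _ (Bx , refl) → x , (Bx , refl) , inj₁ (Bx , refl) })

    spread-source : ∀ n i x y → spread n i x y → F i x
    spread-source n i x y (inj₁ (Bx , _)) = B⊆F i x Bx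
    spread-source n i x y (inj₂ (Fx , _)) = Fx

    Range : ℕ → I → Subset U
    Range n i = image (spread n i) (F i)

    spread-typed : ∀ n i → spread n i ⊆R (F i ⊠ Range n i)
    spread-typed n i x y s = spread-source n i x y s , x , spread-source n i x y s , s

    Range-∩ : ∀ {n m} → n ≢ m → ∀ i → (Range n i ∩ Range m i) ⊆ B i
    Range-∩ n≢m i y ((_ , _ , inj₁ (Bx , refl)) , _) = Bx
    Range-∩ n≢m i y (_ , (_ , _ , inj₁ (Bx , refl))) = Bx
    Range-∩ n≢m i y ((x , _ , inj₂ (Fx , _ , c≡y)) , (x' , _ , inj₂ (Fx' , _ , c'≡y))) =
      ⊥-elim (n≢m (proj₁ (copy-injective i _ _ x x' Fx Fx' (trans c≡y (sym c'≡y)))))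

    β-factor : ∀ n → Σ V λ β → mor (T S) (spread n) α β × mor (T S) collapse β α
    β-factor n = factor-identity F (spread n) collapse (collapse∘spread n) α αF

    -- the α with its points outside B moved to their n-th copies
    β : ℕ → V
    β n = proj₁ (β-factor n)

    β∈Range : ∀ n → obj (T S) (Range n) (β n)
    β∈Range n = proj₂ (mor-typed (T S) F (Range n) (spread n) (spread-typed n) α (β n)
                                 (proj₁ (proj₂ (β-factor n))))

    -- By lax naturality, β n owns only images under spread n of what α owns,
    -- and spread n fixes those.
    own-β : ∀ i n → own S i Everything (β n) ⊆ B i
    own-β i n y o
      with proj₂ (proj₂ (own-lax S i)) F Everything (spread n)
             (λ i x y s → spread-source n i x y s , tt) α y (β n , proj₁ (proj₂ (β-factor n)) , o)
    ... | _ , Bz , inj₁ (_ , refl) = Bz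
    ... | _ , Bz , inj₂ (_ , ¬Bz , _) = ⊥-elim (¬Bz Bz)

    -- The β n form a finitary set of T_own(finite sets); {α} is antifinitary
    -- in T_own(all subsets of F); T collapse is finitary and relates every β n
    -- to α.  Hence β takes only finitely many values.
    β-finite-range : Finite (λ γ → Σ ℕ λ n → β n ≡ γ)
    β-finite-range =
      Finite-⊆ (λ { γ (n , refl) → (n , refl) , α , refl , proj₂ (proj₂ (β-factor n)) })
               (proj₂ (proj₂ (proj₂ collapse-finitary) (singleton α) α-antifinitary) _ β-finitary)
      where
      Small Full : I → FinSpace U
      Small _ = finiteSubsets
      Full i = allSubsets (F i) (xs i , F⊆xs i)
      collapse-finitary : Finitary (Town S Small) (Town S Full) (mor (T S) collapse)
      collapse-finitary = transport Small Full collapse λ i →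
        (λ c x col → tt , collapse-target i c x col) ,
        (λ a _ → lift λ x (c , _ , col) → collapse-target i c x col) ,
        (λ b' _ → (λ _ _ → tt) , λ c (lift finite) → Finite-⊆ (λ _ → proj₁) finite)
        where
        collapse-target : ∀ i c x → collapse i c x → F i x
        collapse-target i c x (inj₁ (Bx , _)) = B⊆F i x Bx
        collapse-target i c x (inj₂ (_ , Fx , _)) = Fx
      α-antifinitary : ortho (web (Town S Full)) (fin (Town S Full)) (singleton α)
      α-antifinitary = (λ { _ refl → αF }) , λ c _ → α ∷ [] , λ { _ (_ , refl) → here refl }
      β-finitary : fin (Town S Small) (λ γ → Σ ℕ λ n → β n ≡ γ)
      β-finitary =
        (λ { _ (n , refl) → obj-mono (Range n) Everything (λ _ _ _ → tt) (β n) (β∈Range n) }) ,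
        λ i → lift (xs i , λ { y (_ , (n , refl) , o) → F⊆xs i y (B⊆F i y (own-β i n y o)) })

    -- Two equal β n = β m with n ≢ m lie in T(Range n ∩ Range m) ⊆ T B, and
    -- collapse is the identity on B, so α ∈ T B.
    α∈TB : obj (T S) B α
    α∈TB with finite-range-repeats β β-finite-range
    ... | n , m , n≢m , βn≡βm =
      restriction-identity B collapse collapse-on-B (β n) α βn∈TB (proj₂ (proj₂ (β-factor n)))
      where
      βn∈TB : obj (T S) B (β n)
      βn∈TB = obj-mono _ B (Range-∩ n≢m) (β n)
                (obj-∩ (Range n) (Range m) (β n) (β∈Range n)
                  (subst (obj (T S) (Range m)) (sym βn≡βm) (β∈Range m)))

  support : ∀ A α → obj (T S) A α → obj (T S) (λ i → own S i A α) α
  support A α αA =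
    obj-mono (Core.B F xs (λ _ _ → proj₁) α αF) (λ i → own S i A α)
             (λ i → own-grow i F A (λ _ _ → proj₂) α αF) α
             (Core.α∈TB F xs (λ _ _ → proj₁) α αF)
    where
    xs : I → List U
    xs = proj₁ (finite-support A α αA)
    F : I → Subset U
    F i = (_∈ xs i) ∩ A i
    αF : obj (T S) F α
    αF = proj₂ (finite-support A α αA)

module ExactContinuity {I U V : Set} (em : ExcludedMiddle (lsuc ℓ0)) (S : TransportSituation I U V)
  (transport : IsTransportFunctor S) (cont : Continuous (T S))
  (J : I → Set) (𝒜 : (i : I) → J i → FinSpace U)
  (directed : ∀ i → Directed⊑ (𝒜 i)) (exact : ∀ i → IsExact (λ j → raw (𝒜 i j))) where
  open Classical em
  open FunctorFacts (T S)
  open OwnFacts S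

  Index : Set
  Index = (i : I) → J i

  W : Index → I → Subset U
  W js i = web (raw (𝒜 i (js i)))

  W∞ : I → Subset U
  W∞ i = ⋃web (λ j → raw (𝒜 i j))

  W⊆W∞ : ∀ js i → W js i ⊆ W∞ i
  W⊆W∞ js i y w = js i , w

  ⊔𝒜 : I → FinSpace U
  ⊔𝒜 i = supFin (𝒜 i)

  G : Index → Raw V
  G js = Town S (λ i → 𝒜 i (js i))

  webs-directed : ∀ i → Directed (λ j → web (raw (𝒜 i j)))
  webs-directed i = proj₁ (directed i) , λ j k → let l , j⊑l , k⊑l = proj₂ (directed i) j k
                                                 in l , proj₁ j⊑l , proj₁ k⊑l

  web-sup : ⋃web G ≐ obj (T S) W∞
  web-sup = swap (cont J (λ i j → web (raw (𝒜 i j))) webs-directed)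

  union⊆bidual : ∀ â → ⋃fin G â → fin (sup G) â
  union⊆bidual = ⊆bidual (⋃web G) (⋃fin G) λ â (js , â⊆T , _) α âα → js , â⊆T α âα

  -- Given y ∈ a' owned by some α ∈ â, choose one such owner; the chosen owners
  -- form an antifinitary set, so finitely many of them lie in â, and by
  -- quasi-functionality they own only finitely many y.
  bidual⊆Town-sup : ∀ â → fin (sup G) â → fin (Town S ⊔𝒜) â
  bidual⊆Town-sup â (â⊆W , â⊥⊥) = (λ α âα → proj₁ web-sup α (â⊆W α âα)) , λ i →
    (λ y (α , _ , o) → own-typed i W∞ α y o) , λ a' a'⊥ → meets-finitely i a' a'⊥
    where
    meets-finitely : ∀ i a' → ortho (W∞ i) (⋃fin (λ j → raw (𝒜 i j))) a' →
                     Finite (a' ∩ image (own S i W∞) â)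
    meets-finitely i a' (_ , a'⊥) =
      Finite-⊆ covered (Finite-image (own-qf S i W∞) (â⊥⊥ chosen chosen-antifinitary))
      where
      owner : Rel U V
      owner y = witness (λ α → â α × own S i W∞ α y)
      owner-qf : QuasiFunctional owner
      owner-qf y = Finite-⊆ (λ { α (_ , refl , w) → w }) (witness-finite _)
      chosen : Subset V
      chosen = image owner a'
      chosen-antifinitary : ortho (⋃web G) (⋃fin G) chosen
      chosen-antifinitary =
        (λ α (_ , _ , w) → â⊆W α (proj₁ (witness-sound _ α w))) ,
        λ ĉ (js , ĉ⊆T , own-fin) →
          Finite-⊆ (λ { α (ĉα , y , a'y , w) → y , ((α , ĉα ,
                          own-shrink i (W js) W∞ (W⊆W∞ js) α (ĉ⊆T α ĉα) y
                            (proj₂ (witness-sound _ α w))) , a'y) , w })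
                   (Finite-image owner-qf (a'⊥ _ (js i , own-fin i)))
      covered : (a' ∩ image (own S i W∞) â) ⊆ image (own S i W∞) (chosen ∩ â)
      covered y (a'y , α , âα , o) =
        let α' , w = witness-exists _ (α , âα , o)
        in α' , ((y , a'y , w) , proj₁ (witness-sound _ α' w)) , proj₂ (witness-sound _ α' w)

  -- By exactness each own_i[â] is finitary in some 𝒜_{i, js i}; the support
  -- lemma (U infinite) or a covering index (U finite) puts â inside T (W js).
  Town-sup⊆union : ∀ â → fin (Town S ⊔𝒜) â → ⋃fin G â
  Town-sup⊆union â (â⊆T , own-fin) with finite-or-infinite
  ... | inj₁ (allU , all∈) = js , â⊆TW , λ i →
          finite-fin (𝒜 i (js i)) _ (allU , λ y _ → all∈ y) (λ y (α , _ , o) → own-typed i (W js) α y o)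
    where
    js : Index
    js i = proj₁ (directed-bound _ (webs-directed i) allU)
    â⊆TW : â ⊆ obj (T S) (W js)
    â⊆TW α âα = obj-mono W∞ (W js) (λ i y w → proj₂ (directed-bound _ (webs-directed i) allU) y (all∈ y) w)
                         α (â⊆T α âα)
  ... | inj₂ fresh = js , â⊆TW , λ i →
          fin-⊆ (𝒜 i (js i)) _ _
            (λ y (α , âα , o) → α , âα , own-grow i (W js) W∞ (W⊆W∞ js) α (â⊆TW α âα) y o)
            (proj₂ (located i))
    where
    open SupportLemma em S transport cont fresh
    located : ∀ i → ⋃fin (λ j → raw (𝒜 i j)) (image (own S i W∞) â)
    located i = proj₂ (exact i _) (own-fin i)
    js : Index
    js i = proj₁ (located i)
    â⊆TW : â ⊆ obj (T S) (W js)
    â⊆TW α âα = obj-mono _ (W js)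
      (λ i y o → fin⊆web (𝒜 i (js i)) _ (proj₂ (located i)) y (α , âα , o)) α (support W∞ α (â⊆T α âα))

  exactly-continuous : IsExact G × (sup G ≈ Town S ⊔𝒜)
  exactly-continuous =
    (λ â → union⊆bidual â , λ â∈bidual → Town-sup⊆union â (bidual⊆Town-sup â â∈bidual)) ,
    web-sup , λ â → bidual⊆Town-sup â , λ â∈Town → union⊆bidual â (Town-sup⊆union â â∈Town)

lemma11 : {I U V : Set} → ExcludedMiddle (lsuc ℓ0) →
    (S : TransportSituation I U V) → IsTransportFunctor S →
    Continuous (T S) → ExactlyContinuous (Town S)
lemma11 em S transport cont =
  Town-mono S ,
  λ J 𝒜 directed exact → ExactContinuity.exactly-continuous em S transport cont J 𝒜 directed exact
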